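{- Let $a\in\mathcal{I}\setminus\{0,k(n-1)\}$. Then $|Low_a|\ge(2L+1)^{\lfloor k/2\rfloor}$.
   Context: Fix positive integers $n,k,L,\rho$ with $\rho\mid k(n-1)$, $k\mid\rho$ and $\rho\ge 12kL$. For $x\in\mathbb{R}^k$, $wt(x)=\sum_i x_i$. The tube is $T_L=\{x\in\{0,\ldots,n-1\}^k:\exists i\in\{0,\ldots,n-1\}\text{ with }|x_c-i|\le L\ \forall c\in[k]\}$. $\mathcal{I}=\{a\in\{0,\ldots,k(n-1)\}:\rho\mid a\}$ and for $a\in\mathcal{I}$, $Low_a=\{x\in T_L:wt(x)=a\}$. -}

module Defs where

open import Data.Nat using (ℕ; zero; suc; _≤_; _≤?_; ∣_-_∣)
open import Data.Fin using (Fin; toℕ)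
open import Data.List using (List; []; _∷_; map; concatMap; filter; length; allFin)
open import Data.List.Relation.Unary.Any as ListAny using ()
open import Data.Vec using (Vec; []; _∷_)
import Data.Vec as Vec
open import Data.Vec.Relation.Unary.All as VAll using (All)
open import Data.Product using (∃)
open import Data.Fin.Properties using (any?)
open import Relation.Nullary using (Dec)
open import Relation.Binary.PropositionalEquality using (_≡_)
import Data.Nat as ℕ

Point : ℕ → ℕ → Set
Point n k = Vec (Fin n) k

allPoints : (n k : ℕ) → List (Point n k)
allPoints n zero = [] ∷ []
allPoints n (suc k) = concatMap (λ i → map (i ∷_) (allPoints n k)) (allFin n)

wt : ∀ {n k} → Point n k → ℕ
wt x = Vec.sum (Vec.map toℕ x)

InTube : ∀ {n k} → ℕ → Point n k → Set
InTube {n} L x = ∃ λ (i : Fin n) → All (λ xc → ∣ toℕ xc - toℕ i ∣ ≤ L) x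

inTube? : ∀ {n k} (L : ℕ) (x : Point n k) → Dec (InTube L x)
inTube? L x = any? (λ i → VAll.all? (λ xc → ∣ toℕ xc - toℕ i ∣ ≤? L) x)

Low : (n k L a : ℕ) → List (Point n k)
Low n k L a = filter (λ x → inTube? L x) (filter (λ x → wt x ℕ.≟ a) (allPoints n k))

cardLow : (n k L a : ℕ) → ℕ
cardLow n k L a = length (Low n k L a)

-- Write a = t·k, which is possible since k ∣ ρ ∣ a. Because a and k(n-1) are distinct
-- multiples of ρ ≥ 12kL, the centre t satisfies L ≤ t and t + L ≤ n - 1. Around the
-- diagonal point (t,…,t) we pair up coordinates: each pair (t - L + j, t + L - j) with
-- 0 ≤ j ≤ 2L has sum 2t and stays within L of t, and a leftover coordinate (k odd) is t.
-- This gives (2L+1)^⌊k/2⌋ distinct points of the tube of weight kt = a.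
module Submission where

open import Defs
open import Data.Nat using (ℕ; _≤_; _≥_; _*_; _+_; _∸_; _^_; _/_)
open import Data.Nat.Divisibility using (_∣_)
open import Relation.Binary.PropositionalEquality using (_≢_)

open import Data.Nat using (zero; suc; _<_; s≤s; s≤s⁻¹; z≤n; ⌊_/2⌋; ∣_-_∣; NonZero; ≢-nonZero; >-nonZero)
open import Data.Nat.Properties
open import Data.Nat.DivMod using (m/n≡1+[m∸n]/n)
open import Data.Nat.Divisibility using (divides; ∣-trans; ∣⇒≤)
open import Algebra.Properties.CommutativeSemigroup +-commutativeSemigroup using () renaming (interchange to +-interchange)
open import Data.Fin using (Fin; toℕ; fromℕ<; opposite)
open import Data.Fin.Properties using (toℕ-fromℕ<; toℕ-injective; toℕ<n; opposite-prop)
open import Data.List using (List; []; _∷_; _++_; map; length; allFin; cartesianProductWith)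
open import Data.List.Properties using (length-removeAt′; length-++; length-map; length-tabulate)
open import Data.List.Membership.Propositional using (_∈_)
open import Data.List.Membership.Propositional.Properties
  using (∈-map⁺; ∈-filter⁺; ∈-concatMap⁺; ∈-allFin; ∈-cartesianProductWith⁻)
open import Data.List.Relation.Binary.Subset.Propositional using (_⊆_)
open import Data.List.Relation.Unary.Any as Any using (here; there; _─_)
open import Data.List.Relation.Unary.All as All using ()
open import Data.List.Relation.Unary.AllPairs using ([]; _∷_)
open import Data.List.Relation.Unary.Unique.Propositional using (Unique)
open import Data.List.Relation.Unary.Unique.Propositional.Properties using (cartesianProductWith⁺; allFin⁺)
open import Data.Vec using ([]; _∷_; head; tail)
open import Data.Vec.Relation.Unary.All using (All; []; _∷_)
open import Data.Product using (_×_; _,_)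
open import Data.Sum using (inj₁; inj₂)
open import Data.Empty using (⊥-elim)
open import Relation.Binary.PropositionalEquality using (_≡_; refl; sym; trans; cong; cong₂; subst; module ≡-Reasoning)

module _ {A : Set} where

  ∈-─⁺ : ∀ {x y : A} {ys : List A} (x∈ys : x ∈ ys) → y ∈ ys → y ≢ x → y ∈ (ys ─ x∈ys)
  ∈-─⁺ (here refl)  (here refl)  y≢x = ⊥-elim (y≢x refl)
  ∈-─⁺ (here refl)  (there y∈ys) y≢x = y∈ys
  ∈-─⁺ (there x∈ys) (here refl)  y≢x = here refl
  ∈-─⁺ (there x∈ys) (there y∈ys) y≢x = there (∈-─⁺ x∈ys y∈ys y≢x)

  Unique-⊆⇒length≤ : ∀ {xs ys : List A} → Unique xs → xs ⊆ ys → length xs ≤ length ys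
  Unique-⊆⇒length≤ {[]}     _            _     = z≤n
  Unique-⊆⇒length≤ {x ∷ xs} {ys} (x∉xs ∷ !xs) xs⊆ys =
    subst (suc (length xs) ≤_) (sym (length-removeAt′ ys (Any.index x∈ys)))
      (s≤s (Unique-⊆⇒length≤ !xs λ y∈xs →
        ∈-─⁺ x∈ys (xs⊆ys (there y∈xs)) (λ y≡x → All.lookup x∉xs y∈xs (sym y≡x))))
    where x∈ys = xs⊆ys (here refl)

length-cartesianProductWith : ∀ {A B C : Set} (f : A → B → C) (xs : List A) (ys : List B) →
                              length (cartesianProductWith f xs ys) ≡ length xs * length ys
length-cartesianProductWith f []       ys = refl
length-cartesianProductWith f (x ∷ xs) ys = begin
  length (map (f x) ys ++ cartesianProductWith f xs ys)     ≡⟨ length-++ (map (f x) ys) ⟩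
  length (map (f x) ys) + length (cartesianProductWith f xs ys)
    ≡⟨ cong₂ _+_ (length-map (f x) ys) (length-cartesianProductWith f xs ys) ⟩
  length ys + length xs * length ys ∎
  where open ≡-Reasoning

2*n≡n+n : ∀ n → 2 * n ≡ n + n
2*n≡n+n n = cong (n +_) (+-identityʳ n)

∣m-n∣≤n : ∀ {m n} → m ≤ n + n → ∣ m - n ∣ ≤ n
∣m-n∣≤n {m} {n} m≤n+n with ∣m-n∣≡[m∸n]∨[n∸m] m n
... | inj₁ eq = subst (_≤ n) (sym eq) (m≤n+o⇒m∸n≤o m n m≤n+n)
... | inj₂ eq = subst (_≤ n) (sym eq) (m∸n≤m n m)

d∣m∧d∣n∧m<n⇒m+d≤n : ∀ {d m n} → d ∣ m → d ∣ n → m < n → m + d ≤ n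
d∣m∧d∣n∧m<n⇒m+d≤n {d} (divides p refl) (divides q refl) pd<qd =
  subst (_≤ q * d) (+-comm d (p * d)) (*-monoˡ-≤ d (*-cancelʳ-< d p q pd<qd))

centre-bounds : ∀ {k N L ρ t} .{{_ : NonZero k}} → k * L ≤ ρ → ρ ∣ t * k → ρ ∣ k * N →
                t * k ≢ 0 → t * k < k * N → L ≤ t × t + L ≤ N
centre-bounds {k} {N} {L} {ρ} {t} kL≤ρ ρ∣tk ρ∣kN tk≢0 tk<kN = L≤t , t+L≤N
  where
    ρ≤tk : ρ ≤ t * k
    ρ≤tk = ∣⇒≤ {{≢-nonZero tk≢0}} ρ∣tk
    L≤t : L ≤ t
    L≤t = *-cancelʳ-≤ L t k (subst (_≤ t * k) (*-comm k L) (≤-trans kL≤ρ ρ≤tk))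
    t+L≤N : t + L ≤ N
    t+L≤N = *-cancelʳ-≤ (t + L) N k (begin
      (t + L) * k   ≡⟨ *-distribʳ-+ k t L ⟩
      t * k + L * k ≡⟨ cong (t * k +_) (*-comm L k) ⟩
      t * k + k * L ≤⟨ +-monoʳ-≤ (t * k) kL≤ρ ⟩
      t * k + ρ     ≤⟨ d∣m∧d∣n∧m<n⇒m+d≤n ρ∣tk ρ∣kN tk<kN ⟩
      k * N         ≡⟨ *-comm k N ⟩
      N * k         ∎)
      where open ≤-Reasoning

n/2≡⌊n/2⌋ : ∀ n → n / 2 ≡ ⌊ n /2⌋
n/2≡⌊n/2⌋ zero          = refl
n/2≡⌊n/2⌋ (suc zero)    = refl
n/2≡⌊n/2⌋ (suc (suc n)) = trans (m/n≡1+[m∸n]/n {suc (suc n)} {2} (s≤s (s≤s z≤n))) (cong suc (n/2≡⌊n/2⌋ n))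

allPoints-complete : ∀ n k (x : Point n k) → x ∈ allPoints n k
allPoints-complete n zero    []      = here refl
allPoints-complete n (suc k) (i ∷ x) =
  ∈-concatMap⁺ (λ i → map (i ∷_) (allPoints n k))
    (Any.map (λ { refl → ∈-map⁺ (i ∷_) (allPoints-complete n k x) }) (∈-allFin i))

∈-Low⁺ : ∀ {n k} L a {x : Point n k} → wt x ≡ a → InTube L x → x ∈ Low n k L a
∈-Low⁺ {n} {k} L a {x} wt≡a inTube =
  ∈-filter⁺ (inTube? L) (∈-filter⁺ (λ x → wt x ≟ a) (allPoints-complete n k x) wt≡a) inTube

module BalancedPoints {N L c : ℕ} (c+2L≤N : c + 2 * L ≤ N) where

  Offset : Set
  Offset = Fin (suc (2 * L))

  toℕ≤2L : (j : Offset) → toℕ j ≤ 2 * L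
  toℕ≤2L j = s≤s⁻¹ (toℕ<n j)

  coord : Offset → Fin (suc N)
  coord j = fromℕ< (s≤s (≤-trans (+-monoʳ-≤ c (toℕ≤2L j)) c+2L≤N))

  toℕ-coord : ∀ j → toℕ (coord j) ≡ c + toℕ j
  toℕ-coord j = toℕ-fromℕ< _

  coord-injective : ∀ {i j} → coord i ≡ coord j → i ≡ j
  coord-injective {i} {j} eq = toℕ-injective (+-cancelˡ-≡ c (toℕ i) (toℕ j)
    (trans (sym (toℕ-coord i)) (trans (cong toℕ eq) (toℕ-coord j))))

  middle : Offset
  middle = fromℕ< (s≤s (m≤m+n L (L + 0)))

  centre : Fin (suc N)
  centre = coord middle

  toℕ-centre : toℕ centre ≡ c + L
  toℕ-centre = trans (toℕ-coord middle) (cong (c +_) (toℕ-fromℕ< _))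

  coord-near-centre : ∀ j → ∣ toℕ (coord j) - toℕ centre ∣ ≤ L
  coord-near-centre j = begin
    ∣ toℕ (coord j) - toℕ centre ∣ ≡⟨ cong₂ ∣_-_∣ (toℕ-coord j) toℕ-centre ⟩
    ∣ c + toℕ j - c + L ∣          ≡⟨ ∣m+n-m+o∣≡∣n-o∣ c (toℕ j) L ⟩
    ∣ toℕ j - L ∣                  ≤⟨ ∣m-n∣≤n (subst (toℕ j ≤_) (2*n≡n+n L) (toℕ≤2L j)) ⟩
    L                              ∎
    where open ≤-Reasoning

  toℕ+toℕ-opposite : ∀ j → toℕ j + toℕ (opposite j) ≡ 2 * L
  toℕ+toℕ-opposite j = trans (cong (toℕ j +_) (opposite-prop j)) (m+[n∸m]≡n (toℕ≤2L j))

  mirror : ∀ {k} → Offset → Point (suc N) k → Point (suc N) (2 + k)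
  mirror j x = coord j ∷ coord (opposite j) ∷ x

  mirror-injective : ∀ {k} {i j} {x y : Point (suc N) k} → mirror i x ≡ mirror j y → i ≡ j × x ≡ y
  mirror-injective eq = coord-injective (cong head eq) , cong (λ v → tail (tail v)) eq

  mirror-weight : ∀ j d → j + d ≡ 2 * L → (c + j) + (c + d) ≡ (c + L) + (c + L)
  mirror-weight j d j+d≡2L = begin
    (c + j) + (c + d) ≡⟨ +-interchange c j c d ⟩
    (c + c) + (j + d) ≡⟨ cong ((c + c) +_) (trans j+d≡2L (2*n≡n+n L)) ⟩
    (c + c) + (L + L) ≡⟨ +-interchange c c L L ⟩
    (c + L) + (c + L) ∎
    where open ≡-Reasoning

  balanced : (k : ℕ) → List (Point (suc N) k)
  balanced zero          = [] ∷ []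
  balanced (suc zero)    = (centre ∷ []) ∷ []
  balanced (suc (suc k)) = cartesianProductWith mirror (allFin (suc (2 * L))) (balanced k)

  length-balanced : ∀ k → length (balanced k) ≡ suc (2 * L) ^ ⌊ k /2⌋
  length-balanced zero          = refl
  length-balanced (suc zero)    = refl
  length-balanced (suc (suc k)) =
    trans (length-cartesianProductWith mirror (allFin (suc (2 * L))) (balanced k))
      (cong₂ _*_ (length-tabulate {n = suc (2 * L)} (λ i → i)) (length-balanced k))

  balanced-unique : ∀ k → Unique (balanced k)
  balanced-unique zero          = All.[] ∷ []
  balanced-unique (suc zero)    = All.[] ∷ []
  balanced-unique (suc (suc k)) =
    cartesianProductWith⁺ mirror mirror-injective (allFin⁺ (suc (2 * L))) (balanced-unique k)

  balanced-weight : ∀ k {x} → x ∈ balanced k → wt x ≡ k * (c + L)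
  balanced-weight zero          (here refl) = refl
  balanced-weight (suc zero)    (here refl) = cong (_+ 0) toℕ-centre
  balanced-weight (suc (suc k)) x∈
    with j , y , _ , y∈ , refl ← ∈-cartesianProductWith⁻ mirror (allFin (suc (2 * L))) (balanced k) x∈ =
    begin
      toℕ (coord j) + (toℕ (coord (opposite j)) + wt y)
        ≡⟨ cong₂ (λ u v → u + (v + wt y)) (toℕ-coord j) (toℕ-coord (opposite j)) ⟩
      (c + toℕ j) + ((c + toℕ (opposite j)) + wt y)
        ≡⟨ +-assoc (c + toℕ j) _ _ ⟨
      ((c + toℕ j) + (c + toℕ (opposite j))) + wt y
        ≡⟨ cong₂ _+_ (mirror-weight (toℕ j) _ (toℕ+toℕ-opposite j)) (balanced-weight k y∈) ⟩
      ((c + L) + (c + L)) + k * (c + L)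
        ≡⟨ +-assoc (c + L) _ _ ⟩
      (c + L) + ((c + L) + k * (c + L)) ∎
    where open ≡-Reasoning

  balanced-near-centre : ∀ k {x} → x ∈ balanced k → All (λ xc → ∣ toℕ xc - toℕ centre ∣ ≤ L) x
  balanced-near-centre zero          (here refl) = []
  balanced-near-centre (suc zero)    (here refl) = coord-near-centre middle ∷ []
  balanced-near-centre (suc (suc k)) x∈
    with j , y , _ , y∈ , refl ← ∈-cartesianProductWith⁻ mirror (allFin (suc (2 * L))) (balanced k) x∈ =
    coord-near-centre j ∷ coord-near-centre (opposite j) ∷ balanced-near-centre k y∈

  balanced⊆Low : ∀ k → balanced k ⊆ Low (suc N) k L (k * (c + L))
  balanced⊆Low k x∈ = ∈-Low⁺ L _ (balanced-weight k x∈) (centre , balanced-near-centre k x∈)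

  ^⌊k/2⌋≤cardLow : ∀ k → suc (2 * L) ^ ⌊ k /2⌋ ≤ cardLow (suc N) k L (k * (c + L))
  ^⌊k/2⌋≤cardLow k = subst (_≤ cardLow (suc N) k L (k * (c + L))) (length-balanced k)
    (Unique-⊆⇒length≤ (balanced-unique k) (balanced⊆Low k))

cardLow-diagonal : ∀ {N L t} k → L ≤ t → t + L ≤ N → (2 * L + 1) ^ (k / 2) ≤ cardLow (suc N) k L (t * k)
cardLow-diagonal {N} {L} {t} k L≤t t+L≤N = begin
  (2 * L + 1) ^ (k / 2)             ≡⟨ cong₂ _^_ (+-comm (2 * L) 1) (n/2≡⌊n/2⌋ k) ⟩
  suc (2 * L) ^ ⌊ k /2⌋             ≤⟨ BalancedPoints.^⌊k/2⌋≤cardLow c+2L≤N k ⟩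
  cardLow (suc N) k L (k * (c + L)) ≡⟨ cong (λ m → cardLow (suc N) k L (k * m)) c+L≡t ⟩
  cardLow (suc N) k L (k * t)       ≡⟨ cong (cardLow (suc N) k L) (*-comm k t) ⟩
  cardLow (suc N) k L (t * k)       ∎
  where
    open ≤-Reasoning
    c = t ∸ L
    c+L≡t : c + L ≡ t
    c+L≡t = m∸n+n≡m L≤t
    c+2L≤N : c + 2 * L ≤ N
    c+2L≤N = begin
      c + 2 * L   ≡⟨ cong (c +_) (2*n≡n+n L) ⟩
      c + (L + L) ≡⟨ +-assoc c L L ⟨
      c + L + L   ≡⟨ cong (_+ L) c+L≡t ⟩
      t + L       ≤⟨ t+L≤N ⟩
      N           ∎

lemma9 : (n k L ρ : ℕ) → n ≥ 1 → k ≥ 1 → L ≥ 1 → ρ ≥ 1 →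
    ρ ∣ k * (n ∸ 1) → k ∣ ρ → ρ ≥ 12 * k * L →
    (a : ℕ) → a ≤ k * (n ∸ 1) → ρ ∣ a → a ≢ 0 → a ≢ k * (n ∸ 1) →
    (2 * L + 1) ^ (k / 2) ≤ cardLow n k L a
lemma9 (suc N) k L ρ _ k≥1 _ _ ρ∣kN k∣ρ ρ≥12kL a a≤kN ρ∣a a≢0 a≢kN
  with divides t refl ← ∣-trans k∣ρ ρ∣a =
  let instance _ = >-nonZero k≥1
      L≤t , t+L≤N = centre-bounds {t = t} kL≤ρ ρ∣a ρ∣kN a≢0 (≤∧≢⇒< a≤kN a≢kN)
  in cardLow-diagonal k L≤t t+L≤N
  where
    kL≤ρ : k * L ≤ ρ
    kL≤ρ = ≤-trans (m≤n*m (k * L) 12) (subst (_≤ ρ) (*-assoc 12 k L) ρ≥12kL)
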